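{- Let $(a_i)$ be a representing sequence with $a_1=k$, and let $(b_i)$ be the $1$-promotion of $(a_i)$. Let $w$ be the representation word of $(a_i)$ and $v$ the representation word of $(b_i)$. Let $\varphi_k$ be the morphism from words over $\{0,\dots,k\}$ to words over $\{0,\dots,k+1\}$ given by $\varphi_k(0)=01$ and $\varphi_k(i)=i+1$ for $i>0$ (applied letter by letter to infinite words). Then $\varphi_k(w)=v$.
   Context: A representing sequence is a strictly increasing sequence $(a_i)_{i\ge0}$ of positive integers with $a_0=1$. For $n\ge1$ with $a_j\le n<a_{j+1}$, the $(a_i)$-representation of $n$ is the digit string $d_j\cdots d_0$ with $n=\sum d_ia_i$ and $\sum d_i$ minimal (greedy); the representation of $0$ is the digit $0$. $n\ge0$ is $2$-volatile if the representation of $n+1$ ends in at least two zeros. The representation word of $(a_i)$ is the infinite word $w$ with $w[n]=a_1$ if $n$ is $2$-volatile and otherwise $w[n]$ equals the last digit of the representation of $n$. The $1$-promotion of $(a_i)$ is the sequence $(b_i)_{i\ge0}$ defined recursively by $b_0=a_0=1$ and, for $i\ge1$, writing $d_{i-1}d_{i-2}\cdots d_0$ for the $(a_h)$-representation of $a_i-1$: $b_i=1+(d_0+1)b_0+\sum_{\ell=1}^{i-1}d_\ell b_\ell$ if $d_0>0$, and $b_i=1+\sum_{\ell=0}^{i-1}d_\ell b_\ell$ otherwise. -}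

module Defs where

open import Data.Nat using (ℕ; zero; suc; _+_; _*_; _∸_; _≤?_)
open import Data.Nat.DivMod using (_/_; _%_)
open import Data.Bool using (Bool; true; false; if_then_else_)
open import Data.List using (List; []; _∷_; _++_; reverse; [_])
open import Relation.Nullary.Decidable using (does)

-- Division / remainder with divisor 0 sent to 0 (never used: a representing
-- sequence is positive).
_div_ : ℕ → ℕ → ℕ
r div zero = 0
r div suc m = r / suc m

_mod_ : ℕ → ℕ → ℕ
r mod zero = r
r mod suc m = r % suc m

-- Largest j ≤ n with a j ≤ n (for a representing sequence this is the j with
-- a j ≤ n < a (j+1), since a j ≥ j + 1).
topFrom : (a : ℕ → ℕ) → ℕ → ℕ → ℕ
topFrom a n zero    = 0
topFrom a n (suc j) = if does (a (suc j) ≤? n) then suc j else topFrom a n j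

top : (a : ℕ → ℕ) → ℕ → ℕ
top a n = topFrom a n n

greedyFrom : (a : ℕ → ℕ) → ℕ → ℕ → List ℕ
greedyFrom a zero    r = (r div a 0) ∷ []
greedyFrom a (suc j) r = (r div a (suc j)) ∷ greedyFrom a j (r mod a (suc j))

rep : (a : ℕ → ℕ) → ℕ → List ℕ
rep a zero    = 0 ∷ []
rep a (suc m) = greedyFrom a (top a (suc m)) (suc m)

at : List ℕ → ℕ → ℕ
at []       _       = 0
at (x ∷ xs) zero    = x
at (x ∷ xs) (suc ℓ) = at xs ℓ

digit : (a : ℕ → ℕ) → ℕ → ℕ → ℕ
digit a n ℓ = at (reverse (rep a n)) ℓ

-- Does a digit string (given least significant first) end in ≥ two zeros?
endsIn00 : List ℕ → Bool
endsIn00 (zero ∷ zero ∷ _) = true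
endsIn00 _                 = false

volatile2 : (a : ℕ → ℕ) → ℕ → Bool
volatile2 a n = endsIn00 (reverse (rep a (suc n)))

repWord : (a : ℕ → ℕ) → ℕ → ℕ
repWord a n = if volatile2 a n then a 1 else digit a n 0

sumBelow : ℕ → (ℕ → ℕ) → ℕ
sumBelow zero    f = 0
sumBelow (suc n) f = sumBelow n f + f n

promoNext : (a : ℕ → ℕ) → ℕ → List ℕ → ℕ
promoNext a zero    bs = 1
promoNext a (suc j) bs with digit a (a (suc j) ∸ 1) 0
... | zero    = 1 + sumBelow (suc j) (λ ℓ → digit a (a (suc j) ∸ 1) ℓ * at bs ℓ)
... | suc d₀  = 1 + (suc d₀ + 1) * at bs 0
                  + sumBelow j (λ ℓ → digit a (a (suc j) ∸ 1) (suc ℓ) * at bs (suc ℓ))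

promoList : (a : ℕ → ℕ) → ℕ → List ℕ
promoList a zero    = []
promoList a (suc i) = promoList a i ++ [ promoNext a i (promoList a i) ]

promotion : (a : ℕ → ℕ) → ℕ → ℕ
promotion a i = at (promoList a (suc i)) i

φ : ℕ → List ℕ
φ zero    = 0 ∷ 1 ∷ []
φ (suc i) = suc (suc i) ∷ []

-- Call the promoted value of n its (a_i)-digits read in base (b_i), with the last digit d₀ raised to
-- d₀ + 1 when d₀ > 0. Passing from n to n + 1 raises it by 2 when d₀ goes from 0 to 1 and by 1
-- otherwise: a carry out of the i lowest digits adds exactly 1, since b_i is one more than the promoted
-- value of a_i − 1. This increment is also the length of φ (w[n]), so the length of φ (w[0..n)) is
-- the promoted value of n, whose greedy (b_i)-digits are therefore the promoted digits of n. Reading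
-- the last digits there gives the letters of v: b_1 = k + 1 when n + 1 ends in 00, else d₀ + 1 when
-- d₀ > 0, and 0 then 1 when d₀ = 0.

module Submission where

open import Defs
open import Data.Nat
open import Data.Nat.Properties
open import Data.Nat.DivMod using (_/_; _%_; m≡m%n+[m/n]*n; m%n<n; m<n⇒m%n≡m; m<n⇒m/n≡0; %-remove-+ˡ; +-distrib-/; m*n%n≡0; m*n/n≡m; n/1≡n)
open import Data.Nat.Divisibility using (n∣m*n)
open import Data.Nat.Tactic.RingSolver using (solve-∀)
open import Algebra.Properties.CommutativeSemigroup +-commutativeSemigroup using (xy∙z≈xz∙y)
open import Data.Bool using (true; false; if_then_else_; T)
open import Data.List using (List; []; _∷_; _++_; [_]; reverse; length; concatMap; applyUpTo)
open import Data.List.Properties using (unfold-reverse; length-reverse; length-++; applyUpTo-∷ʳ; concatMap-++; ++-identityʳ)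
open import Data.Product using (_×_; _,_; proj₁; proj₂; ∃-syntax)
open import Data.Sum using (_⊎_; inj₁; inj₂)
open import Data.Empty using (⊥-elim)
open import Relation.Nullary using (yes; no)
open import Relation.Binary.PropositionalEquality hiding ([_])

mod-unique : ∀ {m} q r x → r < m → x ≡ q * m + r → x mod m ≡ r
mod-unique {suc m} q r _ r<m refl =
  trans (%-remove-+ˡ r (n∣m*n q)) (m<n⇒m%n≡m r<m)

div-unique : ∀ {m} q r x → r < m → x ≡ q * m + r → x div m ≡ q
div-unique {suc m} q r _ r<m refl = begin
  (q * suc m + r) / suc m       ≡⟨ +-distrib-/ (q * suc m) r remainders<m ⟩
  q * suc m / suc m + r / suc m ≡⟨ cong₂ _+_ (m*n/n≡m q (suc m)) (m<n⇒m/n≡0 r<m) ⟩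
  q + 0                         ≡⟨ +-identityʳ q ⟩
  q                             ∎
  where
  open ≡-Reasoning
  remainders<m : q * suc m % suc m + r % suc m < suc m
  remainders<m = subst (_< suc m) (sym (cong₂ _+_ (m*n%n≡0 q (suc m)) (m<n⇒m%n≡m r<m))) r<m

mod-< : ∀ {m} x → 0 < m → x mod m < m
mod-< {suc m} x _ = m%n<n x (suc m)

div-mod-identity : ∀ {m} x → 0 < m → x ≡ x div m * m + x mod m
div-mod-identity {suc m} x _ = trans (m≡m%n+[m/n]*n x (suc m)) (+-comm (x % suc m) _)

modChain : (ℕ → ℕ) → ℕ → ℕ → ℕ → ℕ
modChain s zero    i r = r
modChain s (suc d) i r = modChain s d (suc i) r mod s i

modChain-+ : ∀ (s : ℕ → ℕ) d e i r → modChain s (d + e) i r ≡ modChain s d i (modChain s e (d + i) r)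
modChain-+ s zero    e i r = refl
modChain-+ s (suc d) e i r = cong (_mod s i) (begin
  modChain s (d + e) (suc i) r                  ≡⟨ modChain-+ s d e (suc i) r ⟩
  modChain s d (suc i) (modChain s e (d + suc i) r) ≡⟨ cong (λ j → modChain s d (suc i) (modChain s e j r)) (+-suc d i) ⟩
  modChain s d (suc i) (modChain s e (suc d + i) r) ∎)
  where open ≡-Reasoning

modChain-small : ∀ (s : ℕ → ℕ) d i r → (∀ l → i ≤ l → r < s l) → modChain s d i r ≡ r
modChain-small s zero    i r r<s = refl
modChain-small s (suc d) i r r<s =
  trans (cong (_mod s i) (modChain-small s d (suc i) r (λ l i<l → r<s l (<⇒≤ i<l))))
        (mod-unique 0 r r (r<s i ≤-refl) refl)

-- f l is the value of the l lowest digits of a fixed number, for every l ≥ i.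
Truncations : (ℕ → ℕ) → (ℕ → ℕ) → ℕ → Set
Truncations s f i = ∀ l → i ≤ l → f l < s l × ∃[ q ] f (suc l) ≡ q * s l + f l

modChain-unique : ∀ (s f : ℕ → ℕ) N d i → Truncations s f i → f (d + i) ≡ N → f i ≡ modChain s d i N
modChain-unique s f N zero    i trunc f≡N = f≡N
modChain-unique s f N (suc d) i trunc f≡N with trunc i ≤-refl
... | fi<s , q , split = trans (sym (mod-unique q (f i) (f (suc i)) fi<s split))
  (cong (_mod s i) (modChain-unique s f N d (suc i) (λ l i<l → trunc l (<⇒≤ i<l)) (trans (cong f (+-suc d i)) f≡N)))

at-∷ʳ-length : ∀ xs x ℓ → ℓ ≡ length xs → at (xs ++ [ x ]) ℓ ≡ x
at-∷ʳ-length []       x zero    refl = refl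
at-∷ʳ-length (y ∷ xs) x (suc ℓ) ℓ≡ = at-∷ʳ-length xs x ℓ (suc-injective ℓ≡)

at-∷ʳ-< : ∀ xs x ℓ → ℓ < length xs → at (xs ++ [ x ]) ℓ ≡ at xs ℓ
at-∷ʳ-< (y ∷ xs) x zero    _         = refl
at-∷ʳ-< (y ∷ xs) x (suc ℓ) (s≤s ℓ<) = at-∷ʳ-< xs x ℓ ℓ<

at-≥-length : ∀ xs ℓ → length xs ≤ ℓ → at xs ℓ ≡ 0
at-≥-length []       ℓ       _         = refl
at-≥-length (x ∷ xs) (suc ℓ) (s≤s len≤) = at-≥-length xs ℓ len≤

length-greedyFrom : ∀ (s : ℕ → ℕ) j r → length (reverse (greedyFrom s j r)) ≡ suc j
length-greedyFrom s j r = trans (length-reverse (greedyFrom s j r)) (length-greedy j r)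
  where
  length-greedy : ∀ j r → length (greedyFrom s j r) ≡ suc j
  length-greedy zero    r = refl
  length-greedy (suc j) r = cong suc (length-greedy j _)

topFrom-< : ∀ (s : ℕ → ℕ) n j → n < s (suc j) → n < s (suc (topFrom s n j))
topFrom-< s n zero    n<s = n<s
topFrom-< s n (suc j) n<s with s (suc j) ≤ᵇ n in test
... | true  = n<s
... | false = topFrom-< s n j (≰⇒> λ s≤n → subst T test (≤⇒≤ᵇ s≤n))

endsIn00-zeros : ∀ xs → 2 ≤ length xs → at xs 0 ≡ 0 → at xs 1 ≡ 0 → endsIn00 xs ≡ true
endsIn00-zeros (zero ∷ zero ∷ xs) _         _ _ = refl
endsIn00-zeros (zero ∷ [])        (s≤s ()) _ _

endsIn00-at : ∀ xs → endsIn00 xs ≡ true → at xs 0 ≡ 0 × at xs 1 ≡ 0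
endsIn00-at (zero ∷ zero ∷ xs) _ = refl , refl

record Representing (s : ℕ → ℕ) : Set where
  field
    s0≡1       : s 0 ≡ 1
    increasing : ∀ i → s i < s (suc i)

module Greedy {s : ℕ → ℕ} (S : Representing s) where
  open Representing S

  i<s : ∀ i → i < s i
  i<s zero    = subst (0 <_) (sym s0≡1) z<s
  i<s (suc i) = ≤-<-trans (i<s i) (increasing i)

  s-pos : ∀ i → 0 < s i
  s-pos i = ≤-<-trans z≤n (i<s i)

  s-mono : ∀ {i j} → i ≤ j → s i ≤ s j
  s-mono {i} {j} i≤j = subst (λ k → s i ≤ s k) (m∸n+n≡m i≤j) (s-mono-+ (j ∸ i))
    where
    s-mono-+ : ∀ d → s i ≤ s (d + i)
    s-mono-+ zero    = ≤-refl
    s-mono-+ (suc d) = ≤-trans (s-mono-+ d) (<⇒≤ (increasing (d + i)))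

  suc[s∸1]≡s : ∀ i → suc (s i ∸ 1) ≡ s i
  suc[s∸1]≡s i = trans (+-comm 1 (s i ∸ 1)) (m∸n+n≡m (s-pos i))

  s∸1<s : ∀ i → s i ∸ 1 < s i
  s∸1<s i = subst (s i ∸ 1 <_) (suc[s∸1]≡s i) (n<1+n _)

  <s⇒≤s∸1 : ∀ {n} i → n < s i → n ≤ s i ∸ 1
  <s⇒≤s∸1 i n<s = ≤-pred (subst (_ <_) (sym (suc[s∸1]≡s i)) n<s)

  n<s-suc : ∀ n → n < s (suc n)
  n<s-suc n = <-trans (n<1+n n) (i<s (suc n))

  -- The value of the i lowest digits of the greedy representation of N.
  low : ℕ → ℕ → ℕ
  low i N = modChain s (suc N) i N

  dig : ℕ → ℕ → ℕ
  dig i N = low (suc i) N div s i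

  low≡modChain : ∀ i d N → N < s (d + i) → low i N ≡ modChain s d i N
  low≡modChain i d N N<s = begin
    modChain s (suc N) i N                            ≡⟨ cong (modChain s (suc N) i) (sym (modChain-small s d (suc N + i) N N<above)) ⟩
    modChain s (suc N) i (modChain s d (suc N + i) N) ≡⟨ sym (modChain-+ s (suc N) d i N) ⟩
    modChain s (suc N + d) i N                        ≡⟨ cong (λ e → modChain s e i N) (+-comm (suc N) d) ⟩
    modChain s (d + suc N) i N                        ≡⟨ modChain-+ s d (suc N) i N ⟩
    modChain s d i (modChain s (suc N) (d + i) N)     ≡⟨ cong (modChain s d i) (modChain-small s (suc N) (d + i) N N<from) ⟩
    modChain s d i N                                  ∎
    where
    open ≡-Reasoning
    N<above : ∀ l → suc N + i ≤ l → N < s l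
    N<above l N+i<l = ≤-<-trans (≤-trans (m≤m+n N i) (<⇒≤ N+i<l)) (i<s l)
    N<from : ∀ l → d + i ≤ l → N < s l
    N<from l d+i≤l = <-≤-trans N<s (s-mono d+i≤l)

  low-unique : ∀ (f : ℕ → ℕ) N d i → Truncations s f i → f (d + i) ≡ N → N < s (d + i) → f i ≡ low i N
  low-unique f N d i trunc f≡N N<s = trans (modChain-unique s f N d i trunc f≡N) (sym (low≡modChain i d N N<s))

  low-step : ∀ i N → low i N ≡ low (suc i) N mod s i
  low-step i N = cong (_mod s i) (sym (low≡modChain (suc i) N N (≤-<-trans (m≤m+n N (suc i)) (i<s (N + suc i)))))

  low-< : ∀ i N → low i N < s i
  low-< i N = subst (_< s i) (sym (low-step i N)) (mod-< _ (s-pos i))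

  low-split : ∀ i N → low (suc i) N ≡ dig i N * s i + low i N
  low-split i N = trans (div-mod-identity (low (suc i) N) (s-pos i)) (cong (dig i N * s i +_) (sym (low-step i N)))

  low-small : ∀ i N → N < s i → low i N ≡ N
  low-small i N = low≡modChain i 0 N

  low-truncations : ∀ N i → Truncations s (λ l → low l N) i
  low-truncations N i l _ = low-< l N , dig l N , low-split l N

  low-low : ∀ l i N → l ≤ i → low l (low i N) ≡ low l N
  low-low l i N l≤i = sym (low-unique (λ j → low j N) (low i N) (i ∸ l) l (low-truncations N l)
    (cong (λ j → low j N) (m∸n+n≡m l≤i))
    (subst (λ j → low i N < s j) (sym (m∸n+n≡m l≤i)) (low-< i N)))

  low-zero : ∀ i → low i 0 ≡ 0
  low-zero i = low-small i 0 (s-pos i)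

  low≡0-≤ : ∀ l i N → l ≤ i → low i N ≡ 0 → low l N ≡ 0
  low≡0-≤ l i N l≤i low≡0 = trans (sym (low-low l i N l≤i)) (trans (cong (low l) low≡0) (low-zero l))

  dig≡0 : ∀ i N → low (suc i) N ≡ 0 → dig i N ≡ 0
  dig≡0 i N low≡0 = trans (cong (_div s i) low≡0) (div-unique 0 0 0 (s-pos i) refl)

  dig-small : ∀ i N → N < s i → dig i N ≡ 0
  dig-small i N N<s = trans (cong (_div s i) (low-small (suc i) N (<-trans N<s (increasing i)))) (div-unique 0 N N N<s refl)

  dig-low : ∀ ℓ i N → ℓ < i → dig ℓ (low i N) ≡ dig ℓ N
  dig-low ℓ i N ℓ<i = cong (_div s ℓ) (low-low (suc ℓ) i N ℓ<i)

  dig0≡low1 : ∀ N → dig 0 N ≡ low 1 N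
  dig0≡low1 N = trans (cong (low 1 N div_) s0≡1) (n/1≡n (low 1 N))

  digit≡dig : ∀ m ℓ → digit s m ℓ ≡ dig ℓ m
  digit≡dig zero    zero    = sym (dig≡0 0 0 (low-zero 1))
  digit≡dig zero    (suc ℓ) = sym (dig≡0 (suc ℓ) 0 (low-zero (suc (suc ℓ))))
  digit≡dig (suc m) ℓ       = greedyFrom-dig (top s (suc m)) (suc m) ℓ (topFrom-< s (suc m) (suc m) (n<s-suc (suc m)))
    where
    greedyFrom-dig : ∀ j N ℓ → N < s (suc j) → at (reverse (greedyFrom s j N)) ℓ ≡ dig ℓ N
    greedyFrom-dig j N ℓ N<s with ℓ ≤? j
    ... | no ℓ≰j = trans (at-≥-length (reverse (greedyFrom s j N)) ℓ
                                      (≤-trans (≤-reflexive (length-greedyFrom s j N)) (≰⇒> ℓ≰j)))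
                         (sym (dig-small ℓ N (<-≤-trans N<s (s-mono (≰⇒> ℓ≰j)))))
    greedyFrom-dig zero    N zero N<s | yes _ = cong (_div s 0) (sym (low-small 1 N N<s))
    greedyFrom-dig (suc j) N ℓ N<s | yes ℓ≤1+j
      rewrite unfold-reverse (N div s (suc j)) (greedyFrom s j (N mod s (suc j)))
      with m≤n⇒m<n∨m≡n ℓ≤1+j
    ... | inj₂ refl = trans (at-∷ʳ-length (reverse (greedyFrom s j (N mod s (suc j)))) _ ℓ
                                          (sym (length-greedyFrom s j _)))
                            (cong (_div s ℓ) (sym (low-small (suc ℓ) N N<s)))
    ... | inj₁ (s≤s ℓ≤j) = begin
      at (reverse (greedyFrom s j (N mod s (suc j))) ++ [ N div s (suc j) ]) ℓ
        ≡⟨ at-∷ʳ-< (reverse (greedyFrom s j (N mod s (suc j)))) _ ℓ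
                   (subst (ℓ <_) (sym (length-greedyFrom s j _)) (s≤s ℓ≤j)) ⟩
      at (reverse (greedyFrom s j (N mod s (suc j)))) ℓ
        ≡⟨ greedyFrom-dig j _ ℓ (mod-< N (s-pos (suc j))) ⟩
      dig ℓ (N mod s (suc j))
        ≡⟨ cong (dig ℓ) (sym N-mod≡low) ⟩
      dig ℓ (low (suc j) N)
        ≡⟨ dig-low ℓ (suc j) N (s≤s ℓ≤j) ⟩
      dig ℓ N ∎
      where
      open ≡-Reasoning
      N-mod≡low : low (suc j) N ≡ N mod s (suc j)
      N-mod≡low = trans (low-step (suc j) N) (cong (_mod s (suc j)) (low-small (suc (suc j)) N N<s))

  digit0≡low1 : ∀ m → digit s m 0 ≡ low 1 m
  digit0≡low1 m = trans (digit≡dig m 0) (dig0≡low1 m)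

  repWord-carry : ∀ n → low 2 (suc n) ≡ 0 → repWord s n ≡ s 1
  repWord-carry n low2≡0 = cong (λ b → if b then s 1 else digit s n 0) volatile
    where
    top≥1 : 1 ≤ top s (suc n)
    top≥1 with top s (suc n) | topFrom-< s (suc n) (suc n) (n<s-suc (suc n))
    ... | zero  | n<s1 = ⊥-elim (1+n≢0 (trans (sym (low-small 2 (suc n) (<-trans n<s1 (increasing 1)))) low2≡0))
    ... | suc _ | _    = s≤s z≤n
    volatile : volatile2 s n ≡ true
    volatile = endsIn00-zeros (reverse (rep s (suc n)))
      (subst (2 ≤_) (sym (length-greedyFrom s (top s (suc n)) (suc n))) (s≤s top≥1))
      (trans (digit≡dig (suc n) 0) (dig≡0 0 (suc n) (low≡0-≤ 1 2 (suc n) (s≤s z≤n) low2≡0)))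
      (trans (digit≡dig (suc n) 1) (dig≡0 1 (suc n) low2≡0))

  repWord-noCarry : ∀ n → low 2 (suc n) ≢ 0 → repWord s n ≡ low 1 n
  repWord-noCarry n low2≢0 with volatile2 s n in volatile
  ... | false = digit0≡low1 n
  ... | true  = ⊥-elim (low2≢0 (begin
    low 2 (suc n)                       ≡⟨ low-split 1 (suc n) ⟩
    dig 1 (suc n) * s 1 + low 1 (suc n) ≡⟨ cong₂ (λ d r → d * s 1 + r) dig1≡0 low1≡0 ⟩
    0                                   ∎))
    where
    open ≡-Reasoning
    zeros = endsIn00-at (reverse (rep s (suc n))) volatile
    low1≡0 : low 1 (suc n) ≡ 0
    low1≡0 = trans (sym (digit0≡low1 (suc n))) (proj₁ zeros)
    dig1≡0 : dig 1 (suc n) ≡ 0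
    dig1≡0 = trans (sym (digit≡dig (suc n) 1)) (proj₂ zeros)

  data Increment (i n : ℕ) : Set where
    carry   : low i (suc n) ≡ 0 → suc (low i n) ≡ s i → dig i (suc n) ≡ suc (dig i n) → Increment i n
    noCarry : low i (suc n) ≡ suc (low i n) → dig i (suc n) ≡ dig i n → Increment i n

  increment : ∀ i n → low (suc i) (suc n) ≡ suc (low (suc i) n) → Increment i n
  increment i n next = by-room (m≤n⇒m<n∨m≡n (low-< i n))
    where
    open ≡-Reasoning
    shifted : low (suc i) (suc n) ≡ dig i n * s i + suc (low i n)
    shifted = trans next (trans (cong suc (low-split i n)) (sym (+-suc _ _)))
    by-room : suc (low i n) < s i ⊎ suc (low i n) ≡ s i → Increment i n
    by-room (inj₁ room) = noCarry (trans (low-step i (suc n)) (mod-unique (dig i n) _ _ room shifted))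
                                  (div-unique (dig i n) _ _ room shifted)
    by-room (inj₂ full) = carry (trans (low-step i (suc n)) (mod-unique (suc (dig i n)) 0 _ (s-pos i) wrapped))
                                full (div-unique (suc (dig i n)) 0 _ (s-pos i) wrapped)
      where
      wrapped : low (suc i) (suc n) ≡ suc (dig i n) * s i + 0
      wrapped = begin
        low (suc i) (suc n)           ≡⟨ shifted ⟩
        dig i n * s i + suc (low i n) ≡⟨ cong (dig i n * s i +_) full ⟩
        dig i n * s i + s i           ≡⟨ +-comm (dig i n * s i) (s i) ⟩
        suc (dig i n) * s i           ≡⟨ sym (+-identityʳ _) ⟩
        suc (dig i n) * s i + 0       ∎

  low-suc≢0 : ∀ i n → suc n < s i → low i (suc n) ≢ 0
  low-suc≢0 i n n<s low≡0 = 1+n≢0 (trans (sym (low-small i (suc n) n<s)) low≡0)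

  low-suc : ∀ i n → low i (suc n) ≡ 0 ⊎ low i (suc n) ≡ suc (low i n)
  low-suc i n = from-level (suc n) i (≤-<-trans (m≤m+n (suc n) i) (i<s (suc n + i)))
    where
    from-level : ∀ d i → suc n < s (d + i) → low i (suc n) ≡ 0 ⊎ low i (suc n) ≡ suc (low i n)
    from-level zero    i n<s = inj₂ (trans (low-small i (suc n) n<s) (cong suc (sym (low-small i n (<-trans (n<1+n n) n<s)))))
    from-level (suc d) i n<s with from-level d (suc i) (subst (λ j → suc n < s j) (sym (+-suc d i)) n<s)
    ... | inj₁ wrapped = inj₁ (low≡0-≤ i (suc i) (suc n) (n≤1+n i) wrapped)
    ... | inj₂ next with increment i n next
    ...   | carry wrapped _ _ = inj₁ wrapped
    ...   | noCarry next′ _  = inj₂ next′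

sumBelow-cong : ∀ n f g → (∀ ℓ → ℓ < n → f ℓ ≡ g ℓ) → sumBelow n f ≡ sumBelow n g
sumBelow-cong zero    f g f≗g = refl
sumBelow-cong (suc n) f g f≗g =
  cong₂ _+_ (sumBelow-cong n f g (λ ℓ ℓ<n → f≗g ℓ (<-trans ℓ<n (n<1+n n)))) (f≗g n (n<1+n n))

sumBelow-shift : ∀ n f → sumBelow (suc n) f ≡ f 0 + sumBelow n (λ ℓ → f (suc ℓ))
sumBelow-shift zero    f = +-comm 0 (f 0)
sumBelow-shift (suc n) f = trans (cong (_+ f (suc n)) (sumBelow-shift n f)) (+-assoc (f 0) _ _)

sumBelow-zero : ∀ n → sumBelow n (λ _ → 0) ≡ 0
sumBelow-zero zero    = refl
sumBelow-zero (suc n) = cong (_+ 0) (sumBelow-zero n)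

length-promoList : ∀ a i → length (promoList a i) ≡ i
length-promoList a zero    = refl
length-promoList a (suc i) =
  trans (length-++ (promoList a i)) (trans (+-comm (length (promoList a i)) 1) (cong suc (length-promoList a i)))

promotion≡promoNext : ∀ a i → promotion a i ≡ promoNext a i (promoList a i)
promotion≡promoNext a i = at-∷ʳ-length (promoList a i) _ i (sym (length-promoList a i))

at-promoList : ∀ a i ℓ → ℓ < i → at (promoList a i) ℓ ≡ promotion a ℓ
at-promoList a (suc i) ℓ (s≤s ℓ≤i) with m≤n⇒m<n∨m≡n ℓ≤i
... | inj₁ ℓ<i = trans (at-∷ʳ-< (promoList a i) _ ℓ (subst (ℓ <_) (sym (length-promoList a i)) ℓ<i))
                      (at-promoList a i ℓ ℓ<i)
... | inj₂ refl = refl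

sign : ℕ → ℕ
sign zero    = 0
sign (suc _) = 1

sign-pos : ∀ {x} → 0 < x → sign x ≡ 1
sign-pos {suc x} _ = refl

growth : ℕ → ℕ → ℕ
growth (suc _) zero = 2
growth _       _    = 1

growth-pos : ∀ x y → 0 < growth x y
growth-pos zero    y       = z<s
growth-pos (suc x) zero    = z<s
growth-pos (suc x) (suc y) = z<s

growth-suc : ∀ y x → growth y (suc x) ≡ 1
growth-suc zero    x = refl
growth-suc (suc y) x = refl

sign-growth : ∀ r → sign (suc r) + suc r ≡ sign r + r + growth (suc r) r
sign-growth zero    = refl
sign-growth (suc r) = cong (2 +_) (+-comm 1 r)

applyUpTo-+ : ∀ (g : ℕ → ℕ) m k → applyUpTo g (m + k) ≡ applyUpTo g m ++ applyUpTo (λ t → g (m + t)) k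
applyUpTo-+ g zero    k = refl
applyUpTo-+ g (suc m) k = cong (g 0 ∷_) (applyUpTo-+ (λ t → g (suc t)) m k)

concatMap-applyUpTo-suc : ∀ (f : ℕ → List ℕ) (g : ℕ → ℕ) n →
                          concatMap f (applyUpTo g (suc n)) ≡ concatMap f (applyUpTo g n) ++ f (g n)
concatMap-applyUpTo-suc f g n = begin
  concatMap f (applyUpTo g (suc n))           ≡⟨ cong (concatMap f) (sym (applyUpTo-∷ʳ g n)) ⟩
  concatMap f (applyUpTo g n ++ [ g n ])      ≡⟨ concatMap-++ f (applyUpTo g n) [ g n ] ⟩
  concatMap f (applyUpTo g n) ++ f (g n) ++ [] ≡⟨ cong (concatMap f (applyUpTo g n) ++_) (++-identityʳ (f (g n))) ⟩
  concatMap f (applyUpTo g n) ++ f (g n)      ∎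
  where open ≡-Reasoning

length-φ-pos : ∀ {x} → 0 < x → length (φ x) ≡ 1
length-φ-pos {suc x} _ = refl

φ-pos : ∀ {x} (f : ℕ → ℕ) → 0 < x → f 0 ≡ suc x → φ x ≡ applyUpTo f 1
φ-pos {suc x} f _ f0≡ = cong [_] (sym f0≡)

φ-zero : ∀ (f : ℕ → ℕ) → f 0 ≡ 0 → f 1 ≡ 1 → φ 0 ≡ applyUpTo f 2
φ-zero f f0≡ f1≡ = cong₂ (λ x y → x ∷ y ∷ []) (sym f0≡) (sym f1≡)

module Promotion {a : ℕ → ℕ} (A : Representing a) where
  open Representing A
  open Greedy A

  b : ℕ → ℕ
  b = promotion a

  -- The promoted value of the i lowest digits of n.
  promoted : ℕ → ℕ → ℕ
  promoted i n = sign (low 1 n) + sumBelow i (λ ℓ → dig ℓ n * b ℓ)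

  promoted-suc : ∀ i n → promoted (suc i) n ≡ promoted i n + dig i n * b i
  promoted-suc i n = sym (+-assoc (sign (low 1 n)) _ _)

  promoted-1 : ∀ n → promoted 1 n ≡ sign (low 1 n) + low 1 n
  promoted-1 n = cong (sign (low 1 n) +_) (trans (*-identityʳ (dig 0 n)) (dig0≡low1 n))

  promotion-suc : ∀ j → b (suc j) ≡ suc (promoted (suc j) (a (suc j) ∸ 1))
  promotion-suc j = trans (promotion≡promoNext a (suc j)) promoNext≡
    where
    open ≡-Reasoning
    m = a (suc j) ∸ 1
    F : ℕ → ℕ
    F ℓ = dig ℓ m * b ℓ
    terms : ∀ ℓ → ℓ < suc j → digit a m ℓ * at (promoList a (suc j)) ℓ ≡ F ℓ
    terms ℓ ℓ<1+j = cong₂ _*_ (digit≡dig m ℓ) (at-promoList a (suc j) ℓ ℓ<1+j)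
    promoNext≡ : promoNext a (suc j) (promoList a (suc j)) ≡ suc (promoted (suc j) m)
    promoNext≡ with digit a m 0 in d₀≡
    ... | zero = cong suc (begin
      sumBelow (suc j) (λ ℓ → digit a m ℓ * at (promoList a (suc j)) ℓ)
        ≡⟨ sumBelow-cong (suc j) _ F terms ⟩
      sumBelow (suc j) F
        ≡⟨ cong (λ d → sign d + sumBelow (suc j) F) (trans (sym d₀≡) (digit0≡low1 m)) ⟩
      promoted (suc j) m ∎)
    ... | suc d = begin
      1 + (suc d + 1) * at (promoList a (suc j)) 0 + sumBelow j (λ ℓ → digit a m (suc ℓ) * at (promoList a (suc j)) (suc ℓ))
        ≡⟨ cong₂ (λ b₀ x → 1 + (suc d + 1) * b₀ + x) (at-promoList a (suc j) 0 z<s)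
                 (sumBelow-cong j _ (λ ℓ → F (suc ℓ)) (λ ℓ ℓ<j → terms (suc ℓ) (s≤s ℓ<j))) ⟩
      1 + (suc d + 1) * 1 + sumBelow j (λ ℓ → F (suc ℓ))
        ≡⟨ rearrange d (sumBelow j (λ ℓ → F (suc ℓ))) ⟩
      suc (1 + (suc d * 1 + sumBelow j (λ ℓ → F (suc ℓ))))
        ≡⟨ cong (λ d₀ → suc (sign d₀ + (d₀ * 1 + sumBelow j (λ ℓ → F (suc ℓ))))) low1≡ ⟩
      suc (sign (low 1 m) + (low 1 m * 1 + sumBelow j (λ ℓ → F (suc ℓ))))
        ≡⟨ cong (λ x → suc (sign (low 1 m) + x)) (sym sum≡) ⟩
      suc (promoted (suc j) m) ∎
      where
      low1≡ : suc d ≡ low 1 m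
      low1≡ = trans (sym d₀≡) (digit0≡low1 m)
      sum≡ : sumBelow (suc j) F ≡ low 1 m * 1 + sumBelow j (λ ℓ → F (suc ℓ))
      sum≡ = trans (sumBelow-shift j F) (cong (λ d₀ → d₀ * 1 + sumBelow j (λ ℓ → F (suc ℓ))) (dig0≡low1 m))
      rearrange : ∀ d x → 1 + (suc d + 1) * 1 + x ≡ suc (1 + (suc d * 1 + x))
      rearrange = solve-∀

  promoted-low : ∀ i n → 1 ≤ i → promoted i n ≡ promoted i (low i n)
  promoted-low i n 1≤i = cong₂ _+_ (cong sign (sym (low-low 1 i n 1≤i)))
    (sumBelow-cong i _ _ λ ℓ ℓ<i → cong (_* b ℓ) (sym (dig-low ℓ i n ℓ<i)))

  promoted-of-0 : ∀ i → promoted i 0 ≡ 0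
  promoted-of-0 i = cong₂ _+_ (cong sign (low-zero 1))
    (trans (sumBelow-cong i _ _ λ ℓ _ → cong (_* b ℓ) (dig≡0 ℓ 0 (low-zero (suc ℓ)))) (sumBelow-zero i))

  promoted-wrap : ∀ i n → 1 ≤ i → low i n ≡ 0 → promoted i n ≡ 0
  promoted-wrap i n 1≤i low≡0 = trans (promoted-low i n 1≤i) (trans (cong (promoted i) low≡0) (promoted-of-0 i))

  promoted-full : ∀ j n → suc (low (suc j) n) ≡ a (suc j) → suc (promoted (suc j) n) ≡ b (suc j)
  promoted-full j n full = begin
    suc (promoted (suc j) n)                ≡⟨ cong suc (promoted-low (suc j) n (s≤s z≤n)) ⟩
    suc (promoted (suc j) (low (suc j) n))  ≡⟨ cong (λ m → suc (promoted (suc j) (m ∸ 1))) full ⟩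
    suc (promoted (suc j) (a (suc j) ∸ 1))  ≡⟨ sym (promotion-suc j) ⟩
    b (suc j)                               ∎
    where open ≡-Reasoning

  width : ℕ → ℕ
  width n = growth (low 1 (suc n)) (low 1 n)

  width≡1 : ∀ n → low 1 (suc n) ≡ 0 → width n ≡ 1
  width≡1 n low≡0 = cong (λ d₀ → growth d₀ (low 1 n)) low≡0

  promoted-1-step : ∀ n → low 1 (suc n) ≡ suc (low 1 n) → promoted 1 (suc n) ≡ promoted 1 n + width n
  promoted-1-step n next = begin
    promoted 1 (suc n)                                          ≡⟨ promoted-1 (suc n) ⟩
    sign (low 1 (suc n)) + low 1 (suc n)                        ≡⟨ cong (λ d₀ → sign d₀ + d₀) next ⟩
    sign (suc (low 1 n)) + suc (low 1 n)                        ≡⟨ sign-growth (low 1 n) ⟩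
    sign (low 1 n) + low 1 n + growth (suc (low 1 n)) (low 1 n) ≡⟨ cong₂ _+_ (sym (promoted-1 n))
                                                                           (cong (λ d₀ → growth d₀ (low 1 n)) (sym next)) ⟩
    promoted 1 n + width n                                      ∎
    where open ≡-Reasoning

  -- Before the carry the j + 1 lowest digits have promoted value b (j + 1) − 1, after it 0.
  promoted-step-carry : ∀ j n → low (suc j) (suc n) ≡ 0 → suc (low (suc j) n) ≡ a (suc j) →
                        dig (suc j) (suc n) ≡ suc (dig (suc j) n) →
                        promoted (suc (suc j)) (suc n) ≡ promoted (suc (suc j)) n + width n
  promoted-step-carry j n wrapped full dig+1 = begin
    promoted (suc (suc j)) (suc n)                             ≡⟨ promoted-suc (suc j) (suc n) ⟩
    promoted (suc j) (suc n) + dig (suc j) (suc n) * b (suc j) ≡⟨ cong₂ (λ p d → p + d * b (suc j)) promoted≡0 dig+1 ⟩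
    suc d * b (suc j)                                          ≡⟨ cong (suc d *_) (sym (promoted-full j n full)) ⟩
    suc d * suc p                                              ≡⟨ carry-arithmetic p d ⟩
    p + d * suc p + 1                                          ≡⟨ cong₂ (λ x w → p + d * x + w)
                                                                        (promoted-full j n full) (sym width≡1′) ⟩
    p + d * b (suc j) + width n                                ≡⟨ cong (_+ width n) (sym (promoted-suc (suc j) n)) ⟩
    promoted (suc (suc j)) n + width n                         ∎
    where
    open ≡-Reasoning
    p = promoted (suc j) n
    d = dig (suc j) n
    promoted≡0 : promoted (suc j) (suc n) ≡ 0
    promoted≡0 = promoted-wrap (suc j) (suc n) (s≤s z≤n) wrapped
    width≡1′ : width n ≡ 1
    width≡1′ = width≡1 n (low≡0-≤ 1 (suc j) (suc n) (s≤s z≤n) wrapped)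
    carry-arithmetic : ∀ p d → suc d * suc p ≡ p + d * suc p + 1
    carry-arithmetic = solve-∀

  promoted-step : ∀ j n → low (suc j) (suc n) ≢ 0 → promoted (suc j) (suc n) ≡ promoted (suc j) n + width n
  promoted-step zero n low≢0 with low-suc 1 n
  ... | inj₁ low≡0 = ⊥-elim (low≢0 low≡0)
  ... | inj₂ next  = promoted-1-step n next
  promoted-step (suc j) n low≢0 with low-suc (suc (suc j)) n
  ... | inj₁ low≡0 = ⊥-elim (low≢0 low≡0)
  ... | inj₂ next with increment (suc j) n next
  ...   | carry wrapped full dig+1 = promoted-step-carry j n wrapped full dig+1
  ...   | noCarry next′ dig-same = begin
    promoted (suc (suc j)) (suc n)                             ≡⟨ promoted-suc (suc j) (suc n) ⟩
    promoted (suc j) (suc n) + dig (suc j) (suc n) * b (suc j) ≡⟨ cong₂ (λ p d → p + d * b (suc j))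
                                                                        (promoted-step j n low′≢0) dig-same ⟩
    promoted (suc j) n + width n + dig (suc j) n * b (suc j)   ≡⟨ xy∙z≈xz∙y (promoted (suc j) n) (width n) _ ⟩
    promoted (suc j) n + dig (suc j) n * b (suc j) + width n   ≡⟨ cong (_+ width n) (sym (promoted-suc (suc j) n)) ⟩
    promoted (suc (suc j)) n + width n                         ∎
    where
    open ≡-Reasoning
    low′≢0 : low (suc j) (suc n) ≢ 0
    low′≢0 low≡0 = 1+n≢0 (trans (sym next′) low≡0)

  promoted-<-suc : ∀ j m → suc m < a (suc j) → promoted (suc j) m < promoted (suc j) (suc m)
  promoted-<-suc j m m<a = subst (promoted (suc j) m <_) (sym (promoted-step j m (low-suc≢0 (suc j) m m<a)))
                                 (m<m+n (promoted (suc j) m) (growth-pos _ _))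

  promoted-mono : ∀ j {m m′} → m ≤ m′ → m′ < a (suc j) → promoted (suc j) m ≤ promoted (suc j) m′
  promoted-mono j {m′ = zero}   z≤n  _    = ≤-refl
  promoted-mono j {m′ = suc m′} m≤m′ m′<a with m≤n⇒m<n∨m≡n m≤m′
  ... | inj₂ refl     = ≤-refl
  ... | inj₁ (s≤s m≤) = ≤-trans (promoted-mono j m≤ (<-trans (n<1+n m′) m′<a)) (<⇒≤ (promoted-<-suc j m′ m′<a))

  promoted-< : ∀ j n → promoted (suc j) n < b (suc j)
  promoted-< j n = begin-strict
    promoted (suc j) n                 ≡⟨ promoted-low (suc j) n (s≤s z≤n) ⟩
    promoted (suc j) (low (suc j) n)   ≤⟨ promoted-mono j (<s⇒≤s∸1 (suc j) (low-< (suc j) n)) (s∸1<s (suc j)) ⟩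
    promoted (suc j) (a (suc j) ∸ 1)   <⟨ n<1+n _ ⟩
    suc (promoted (suc j) (a (suc j) ∸ 1)) ≡⟨ sym (promotion-suc j) ⟩
    b (suc j)                          ∎
    where open ≤-Reasoning

  promotion-1 : b 1 ≡ suc (a 1)
  promotion-1 = begin
    b 1                                            ≡⟨ promotion-suc 0 ⟩
    suc (promoted 1 (a 1 ∸ 1))                     ≡⟨ cong suc (promoted-1 (a 1 ∸ 1)) ⟩
    suc (sign (low 1 (a 1 ∸ 1)) + low 1 (a 1 ∸ 1)) ≡⟨ cong (λ d₀ → suc (sign d₀ + d₀)) (low-small 1 _ (s∸1<s 1)) ⟩
    suc (sign (a 1 ∸ 1) + (a 1 ∸ 1))               ≡⟨ cong (λ σ → suc (σ + (a 1 ∸ 1))) (sign-pos (m<n⇒0<n∸m (i<s 1))) ⟩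
    suc (suc (a 1 ∸ 1))                            ≡⟨ cong suc (suc[s∸1]≡s 1) ⟩
    suc (a 1)                                      ∎
    where open ≡-Reasoning

  promotion-increasing : ∀ i → b i < b (suc i)
  promotion-increasing zero    = subst (1 <_) (sym promotion-1) (s≤s (s-pos 1))
  promotion-increasing (suc j) = begin-strict
    b (suc j)                      ≡⟨ promotion-suc j ⟩
    suc (promoted (suc j) x)       ≡⟨ cong suc (sym top-digit-vanishes) ⟩
    suc (promoted (suc (suc j)) x) ≤⟨ promoted-<-suc (suc j) x x+1<a ⟩
    promoted (suc (suc j)) (suc x) <⟨ promoted-< (suc j) (suc x) ⟩
    b (suc (suc j))                ∎
    where
    open ≤-Reasoning
    x = a (suc j) ∸ 1
    x+1<a : suc x < a (suc (suc j))
    x+1<a = subst (_< a (suc (suc j))) (sym (suc[s∸1]≡s (suc j))) (increasing (suc j))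
    top-digit-vanishes : promoted (suc (suc j)) x ≡ promoted (suc j) x
    top-digit-vanishes = trans (promoted-suc (suc j) x)
      (trans (cong (λ d → promoted (suc j) x + d * b (suc j)) (dig-small (suc j) x (s∸1<s (suc j)))) (+-identityʳ _))

  promotionRepresenting : Representing b
  promotionRepresenting = record { s0≡1 = refl ; increasing = promotion-increasing }

  promoted≡0⇒low≡0 : ∀ i n → promoted i n ≡ 0 → low i n ≡ 0
  promoted≡0⇒low≡0 zero    n _          = n<1⇒n≡0 (subst (low 0 n <_) s0≡1 (low-< 0 n))
  promoted≡0⇒low≡0 (suc i) n promoted≡0 = begin
    low (suc i) n           ≡⟨ low-split i n ⟩
    dig i n * a i + low i n ≡⟨ cong₂ (λ d r → d * a i + r) dig≡0′ (promoted≡0⇒low≡0 i n (m+n≡0⇒m≡0 _ sum≡0)) ⟩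
    0                       ∎
    where
    open ≡-Reasoning
    sum≡0 : promoted i n + dig i n * b i ≡ 0
    sum≡0 = trans (sym (promoted-suc i n)) promoted≡0
    dig≡0′ : dig i n ≡ 0
    dig≡0′ with m*n≡0⇒m≡0∨n≡0 (dig i n) (m+n≡0⇒n≡0 (promoted i n) sum≡0)
    ... | inj₁ d≡0 = d≡0
    ... | inj₂ b≡0 = ⊥-elim (<⇒≢ (Greedy.s-pos promotionRepresenting i) (sym b≡0))

module Words {a : ℕ → ℕ} (A : Representing a) where
  open Greedy A
  open Promotion A
  private module B = Greedy promotionRepresenting

  w v : ℕ → ℕ
  w = repWord a
  v = repWord b

  image : ℕ → List ℕ
  image n = concatMap φ (applyUpTo w n)

  offset : ℕ → ℕ
  offset n = length (image n)

  low1-after-0 : ∀ n → low 2 (suc n) ≢ 0 → low 1 n ≡ 0 → low 1 (suc n) ≡ 1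
  low1-after-0 n low2≢0 low1≡0 with low-suc 2 n
  ... | inj₁ low2≡0 = ⊥-elim (low2≢0 low2≡0)
  ... | inj₂ next with increment 1 n next
  ...   | carry _ full _  = ⊥-elim (<⇒≢ (i<s 1) (trans (cong suc (sym low1≡0)) full))
  ...   | noCarry next′ _ = trans next′ (cong suc low1≡0)

  length-φ-w : ∀ n → length (φ (w n)) ≡ width n
  length-φ-w n with low 2 (suc n) ≟ 0
  ... | yes low2≡0 = begin
    length (φ (w n)) ≡⟨ cong (λ x → length (φ x)) (repWord-carry n low2≡0) ⟩
    length (φ (a 1)) ≡⟨ length-φ-pos (s-pos 1) ⟩
    1                ≡⟨ sym (width≡1 n (low≡0-≤ 1 2 (suc n) (s≤s z≤n) low2≡0)) ⟩
    width n          ∎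
    where open ≡-Reasoning
  ... | no low2≢0 = trans (cong (λ x → length (φ x)) (repWord-noCarry n low2≢0)) (by-last-digit (low 1 n) refl)
    where
    by-last-digit : ∀ d₀ → low 1 n ≡ d₀ → length (φ (low 1 n)) ≡ width n
    by-last-digit zero    d₀≡0 rewrite d₀≡0 | low1-after-0 n low2≢0 d₀≡0 = refl
    by-last-digit (suc x) d₀≡  rewrite d₀≡ = sym (growth-suc (low 1 (suc n)) x)

  offset-suc : ∀ n → offset (suc n) ≡ offset n + width n
  offset-suc n = trans (cong length (concatMap-applyUpTo-suc φ w n))
                       (trans (length-++ (image n)) (cong (offset n +_) (length-φ-w n)))

  promoted≡offset : ∀ j n → n < a (suc j) → promoted (suc j) n ≡ offset n
  promoted≡offset j zero    _   = promoted-of-0 (suc j)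
  promoted≡offset j (suc n) n<a = begin
    promoted (suc j) (suc n)     ≡⟨ promoted-step j n (low-suc≢0 (suc j) n n<a) ⟩
    promoted (suc j) n + width n ≡⟨ cong (_+ width n) (promoted≡offset j n (<-trans (n<1+n n) n<a)) ⟩
    offset n + width n           ≡⟨ sym (offset-suc n) ⟩
    offset (suc n)               ∎
    where open ≡-Reasoning

  -- The (b_ℓ)-digits of c + offset n are the promoted (a_ℓ)-digits of n, the last one raised by c.
  lowᵇ-offset : ∀ c n → (∀ l → c + promoted (suc l) n < b (suc l)) →
                ∀ j → B.low (suc j) (c + offset n) ≡ c + promoted (suc j) n
  lowᵇ-offset c n bounded j =
    sym (B.low-unique (λ l → c + promoted l n) (c + offset n) d (suc j) truncations at-top top<b)
    where
    -- at level d + j + 1 neither c + offset n nor n is truncated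
    d = c + offset n + n
    n<a : n < a (suc (d + j))
    n<a = ≤-<-trans (≤-trans (m≤n+m n (c + offset n)) (≤-trans (m≤m+n d j) (n≤1+n (d + j)))) (i<s _)
    truncations : Truncations b (λ l → c + promoted l n) (suc j)
    truncations (suc l) _ = bounded l , dig (suc l) n , (begin
      c + promoted (suc (suc l)) n                         ≡⟨ cong (c +_) (promoted-suc (suc l) n) ⟩
      c + (promoted (suc l) n + dig (suc l) n * b (suc l)) ≡⟨ rearrange c (promoted (suc l) n) (dig (suc l) n * b (suc l)) ⟩
      dig (suc l) n * b (suc l) + (c + promoted (suc l) n) ∎)
      where
      open ≡-Reasoning
      rearrange : ∀ x y z → x + (y + z) ≡ z + (x + y)
      rearrange = solve-∀
    at-top : c + promoted (d + suc j) n ≡ c + offset n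
    at-top = cong (c +_) (trans (cong (λ i → promoted i n) (+-suc d j)) (promoted≡offset (d + j) n n<a))
    top<b : c + offset n < b (d + suc j)
    top<b = ≤-<-trans (≤-trans (m≤m+n (c + offset n) n) (m≤m+n d (suc j))) (B.i<s _)

  lowᵇ-offset₀ : ∀ n j → B.low (suc j) (offset n) ≡ promoted (suc j) n
  lowᵇ-offset₀ n = lowᵇ-offset 0 n (λ l → promoted-< l n)

  offset-suc-width : ∀ n k → width n ≡ k → offset (suc n) ≡ k + offset n
  offset-suc-width n k width≡k = trans (offset-suc n) (trans (cong (offset n +_) width≡k) (+-comm (offset n) k))

  lowᵇ-offset≢0 : ∀ n → low 2 (suc n) ≢ 0 → B.low 2 (offset (suc n)) ≢ 0
  lowᵇ-offset≢0 n low2≢0 lowᵇ≡0 =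
    low2≢0 (promoted≡0⇒low≡0 2 (suc n) (trans (sym (lowᵇ-offset₀ (suc n) 1)) lowᵇ≡0))

  v-offset : ∀ n → B.low 2 (suc (offset n)) ≢ 0 → v (offset n) ≡ sign (low 1 n) + low 1 n
  v-offset n lowᵇ≢0 = trans (B.repWord-noCarry (offset n) lowᵇ≢0) (trans (lowᵇ-offset₀ n 0) (promoted-1 n))

  Segment : ℕ → Set
  Segment n = φ (w n) ≡ applyUpTo (λ t → v (offset n + t)) (width n)

  segment-carry : ∀ n → low 2 (suc n) ≡ 0 → Segment n
  segment-carry n low2≡0 = begin
    φ (w n)               ≡⟨ cong φ (repWord-carry n low2≡0) ⟩
    φ (a 1)               ≡⟨ φ-pos F (s-pos 1) v₀ ⟩
    applyUpTo F 1         ≡⟨ cong (applyUpTo F) (sym width≡1′) ⟩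
    applyUpTo F (width n) ∎
    where
    open ≡-Reasoning
    F : ℕ → ℕ
    F t = v (offset n + t)
    width≡1′ : width n ≡ 1
    width≡1′ = width≡1 n (low≡0-≤ 1 2 (suc n) (s≤s z≤n) low2≡0)
    lowᵇ≡0 : B.low 2 (suc (offset n)) ≡ 0
    lowᵇ≡0 = begin
      B.low 2 (suc (offset n)) ≡⟨ cong (B.low 2) (sym (offset-suc-width n 1 width≡1′)) ⟩
      B.low 2 (offset (suc n)) ≡⟨ lowᵇ-offset₀ (suc n) 1 ⟩
      promoted 2 (suc n)       ≡⟨ promoted-wrap 2 (suc n) (s≤s z≤n) low2≡0 ⟩
      0                        ∎
    v₀ : F 0 ≡ suc (a 1)
    v₀ = trans (cong v (+-identityʳ (offset n))) (trans (B.repWord-carry (offset n) lowᵇ≡0) promotion-1)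

  segment-pos : ∀ n x → low 2 (suc n) ≢ 0 → low 1 n ≡ suc x → Segment n
  segment-pos n x low2≢0 d₀≡ = begin
    φ (w n)               ≡⟨ cong φ (trans (repWord-noCarry n low2≢0) d₀≡) ⟩
    φ (suc x)             ≡⟨ φ-pos F z<s v₀ ⟩
    applyUpTo F 1         ≡⟨ cong (applyUpTo F) (sym width≡1′) ⟩
    applyUpTo F (width n) ∎
    where
    open ≡-Reasoning
    F : ℕ → ℕ
    F t = v (offset n + t)
    width≡1′ : width n ≡ 1
    width≡1′ = trans (cong (growth (low 1 (suc n))) d₀≡) (growth-suc _ x)
    lowᵇ≢0 : B.low 2 (suc (offset n)) ≢ 0
    lowᵇ≢0 = subst (λ m → B.low 2 m ≢ 0) (offset-suc-width n 1 width≡1′) (lowᵇ-offset≢0 n low2≢0)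
    v₀ : F 0 ≡ suc (suc x)
    v₀ = trans (cong v (+-identityʳ (offset n))) (trans (v-offset n lowᵇ≢0) (cong (λ d₀ → sign d₀ + d₀) d₀≡))

  promoted-room : ∀ n → low 1 (suc n) ≡ 1 → low 1 n ≡ 0 → ∀ l → 1 + promoted (suc l) n < b (suc l)
  promoted-room n d₀′≡1 d₀≡0 l = begin-strict
    1 + promoted (suc l) n       <⟨ n<1+n _ ⟩
    2 + promoted (suc l) n       ≡⟨ +-comm 2 _ ⟩
    promoted (suc l) n + 2       ≡⟨ cong (promoted (suc l) n +_) (sym (cong₂ growth d₀′≡1 d₀≡0)) ⟩
    promoted (suc l) n + width n ≡⟨ sym (promoted-step l n low≢0) ⟩
    promoted (suc l) (suc n)     <⟨ promoted-< l (suc n) ⟩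
    b (suc l)                    ∎
    where
    open ≤-Reasoning
    low≢0 : low (suc l) (suc n) ≢ 0
    low≢0 low≡0 = 1+n≢0 (trans (sym d₀′≡1) (low≡0-≤ 1 (suc l) (suc n) (s≤s z≤n) low≡0))

  segment-zero : ∀ n → low 2 (suc n) ≢ 0 → low 1 n ≡ 0 → Segment n
  segment-zero n low2≢0 d₀≡0 = begin
    φ (w n)               ≡⟨ cong φ (trans (repWord-noCarry n low2≢0) d₀≡0) ⟩
    φ 0                   ≡⟨ φ-zero F v₀ v₁ ⟩
    applyUpTo F 2         ≡⟨ cong (applyUpTo F) (sym width≡2) ⟩
    applyUpTo F (width n) ∎
    where
    open ≡-Reasoning
    F : ℕ → ℕ
    F t = v (offset n + t)
    d₀′≡1 : low 1 (suc n) ≡ 1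
    d₀′≡1 = low1-after-0 n low2≢0 d₀≡0
    width≡2 : width n ≡ 2
    width≡2 = cong₂ growth d₀′≡1 d₀≡0
    room : ∀ l → 1 + promoted (suc l) n < b (suc l)
    room = promoted-room n d₀′≡1 d₀≡0
    lowᵇ≢0 : B.low 2 (suc (offset n)) ≢ 0
    lowᵇ≢0 lowᵇ≡0 = 1+n≢0 (trans (sym (lowᵇ-offset 1 n room 1)) lowᵇ≡0)
    lowᵇ′≢0 : B.low 2 (suc (suc (offset n))) ≢ 0
    lowᵇ′≢0 = subst (λ m → B.low 2 m ≢ 0) (offset-suc-width n 2 width≡2) (lowᵇ-offset≢0 n low2≢0)
    v₀ : F 0 ≡ 0
    v₀ = trans (cong v (+-identityʳ (offset n))) (trans (v-offset n lowᵇ≢0) (cong (λ d₀ → sign d₀ + d₀) d₀≡0))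
    v₁ : F 1 ≡ 1
    v₁ = begin
      v (offset n + 1)               ≡⟨ cong v (+-comm (offset n) 1) ⟩
      v (suc (offset n))             ≡⟨ B.repWord-noCarry (suc (offset n)) lowᵇ′≢0 ⟩
      B.low 1 (1 + offset n)         ≡⟨ lowᵇ-offset 1 n room 0 ⟩
      1 + promoted 1 n               ≡⟨ cong suc (trans (promoted-1 n) (cong (λ d₀ → sign d₀ + d₀) d₀≡0)) ⟩
      1                              ∎

  segment : ∀ n → Segment n
  segment n with low 2 (suc n) ≟ 0
  ... | yes low2≡0 = segment-carry n low2≡0
  ... | no  low2≢0 = by-last-digit (low 1 n) refl
    where
    by-last-digit : ∀ d₀ → low 1 n ≡ d₀ → Segment n
    by-last-digit zero    d₀≡0 = segment-zero n low2≢0 d₀≡0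
    by-last-digit (suc x) d₀≡  = segment-pos n x low2≢0 d₀≡

  image≡prefix : ∀ n → image n ≡ applyUpTo v (offset n)
  image≡prefix zero    = refl
  image≡prefix (suc n) = begin
    image (suc n)                                                          ≡⟨ concatMap-applyUpTo-suc φ w n ⟩
    image n ++ φ (w n)                                                     ≡⟨ cong₂ _++_ (image≡prefix n) (segment n) ⟩
    applyUpTo v (offset n) ++ applyUpTo (λ t → v (offset n + t)) (width n) ≡⟨ sym (applyUpTo-+ v (offset n) (width n)) ⟩
    applyUpTo v (offset n + width n)                                       ≡⟨ cong (applyUpTo v) (sym (offset-suc n)) ⟩
    applyUpTo v (offset (suc n))                                           ∎
    where open ≡-Reasoning

theoremE4 : (a : ℕ → ℕ) → a 0 ≡ 1 → (∀ i → a i < a (suc i)) →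
            (k : ℕ) → a 1 ≡ k →
            (∀ n → concatMap φ (applyUpTo (repWord a) n)
                     ≡ applyUpTo (repWord (promotion a)) (length (concatMap φ (applyUpTo (repWord a) n))))
-- φ does not depend on k.
theoremE4 a a0≡1 increasing _ _ = Words.image≡prefix (record { s0≡1 = a0≡1 ; increasing = increasing })
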